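{- Let $t,u,v,w$ be terms, let $\phi$ and $\psi_1,\dots,\psi_n$ be quantifier-free symbolic heaps, and let $z$ be a variable not occurring in $t,u,v,w,\phi,\psi_1,\dots,\psi_n$. Writing $\Psi$ for $\psi_1\lor\cdots\lor\psi_n$, the following are equivalent: (1) $\mathrm{dll}(t,u,v,w)*\phi\models\Psi$; (2) $t=u\land v=w\land\phi\models\Psi$, and $t=v\land t\mapsto(u,w)*\phi\models\Psi$, and $t\mapsto(z,w)*z\mapsto(v,t)*v\mapsto(u,z)*\phi\models\Psi$.
   Context: Terms: $t::=x\mid0\mid1\mid\cdots\mid t+t$, interpreted in $N$ by a store $s$ (a map from variables to $N$, with $s(n)=n$, $s(t+u)=s(t)+s(u)$). A heap is a finite partial function $h$ from $N\setminus\{0\}$ to $N^2$. Quantifier-free symbolic heaps are $\Pi\land\Sigma$ with $\Pi$ a Presburger formula and $\Sigma::=\mathrm{Emp}\mid t\mapsto(t,t)\mid\mathrm{Arr}(t,t)\mid\mathrm{ls}(t,t)\mid\mathrm{dll}(t,t,t,t)\mid\Sigma*\Sigma$. Satisfaction: pure formulas hold iff true under $s$; $s,h\models\mathrm{Emp}$ iff $\mathrm{Dom}(h)=\emptyset$; $s,h\models t\mapsto(u,v)$ iff $\mathrm{Dom}(h)=\{s(t)\}$ and $h(s(t))=(s(u),s(v))$; $s,h\models\mathrm{Arr}(t,u)$ iff $s(t)\le s(u)$ and $\mathrm{Dom}(h)=\{x\mid s(t)\le x\le s(u)\}$; $s,h\models F_1*F_2$ iff $h=h_1+h_2$ (disjoint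 union) with $s,h_i\models F_i$; $\land,\lor,\exists$ classical. List predicates: $s,h\models\mathrm{ls}(t,u)$ iff $s,h\models\mathrm{ls}^k(t,u)$ for some $k\ge0$, and $s,h\models\mathrm{dll}(t,u,v,w)$ iff $s,h\models\mathrm{dll}^k(t,u,v,w)$ for some $k$, where $\mathrm{ls}^0$ and $\mathrm{dll}^0$ are $0\ne0\land\mathrm{Emp}$, $\mathrm{ls}^{k+1}(t,u)=(t=u\land\mathrm{Emp})\lor\exists z w(t\mapsto(z,w)*\mathrm{ls}^k(z,u))$, and $\mathrm{dll}^{k+1}(t,u,v,w)=(t=u\land v=w\land\mathrm{Emp})\lor\exists z(t\mapsto(z,w)*\mathrm{dll}^k(z,u,v,t))$. $F\models G$ means that for all $s,h$, $s,h\models F$ implies $s,h\models G$. -}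

module Defs where

open import Data.Nat using (ℕ; _+_; _≤_; _≟_)
open import Data.Maybe using (Maybe; just; nothing; Is-just)
open import Data.Product using (_×_; _,_; Σ; ∃; ∃-syntax)
open import Data.Sum using (_⊎_)
open import Data.Empty using (⊥)
open import Data.Unit using (⊤)
open import Data.List using (List; []; _∷_)
open import Data.List.NonEmpty using (List⁺; _∷_)
open import Relation.Nullary using (¬_; yes; no)
open import Relation.Binary.PropositionalEquality using (_≡_; _≢_)

Var : Set
Var = ℕ

data Term : Set where
  var  : Var → Term
  lit  : ℕ → Term
  _⊕_  : Term → Term → Term

data Pure : Set where
  _≐_   : Term → Term → Pure
  _≼_   : Term → Term → Pure
  ¬ᵖ_   : Pure → Pure
  _∧ᵖ_  : Pure → Pure → Pure
  _∨ᵖ_  : Pure → Pure → Pure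
  ∃ᵖ    : Var → Pure → Pure
  ∀ᵖ    : Var → Pure → Pure

data Spatial : Set where
  emp  : Spatial
  _↦⟨_,_⟩ : Term → Term → Term → Spatial
  arr  : Term → Term → Spatial
  ls   : Term → Term → Spatial
  dll  : Term → Term → Term → Term → Spatial
  _✱_  : Spatial → Spatial → Spatial

record SH : Set where
  constructor _∧ₛ_
  field
    pureP : Pure
    spat  : Spatial

data Form : Set where
  pure   : Pure → Form
  spatial : Spatial → Form
  _⋆_    : Form → Form → Form
  _∧ᶠ_   : Form → Form → Form
  _∨ᶠ_   : Form → Form → Form
  ∃ᶠ     : Var → Form → Form

⌜_⌝ : SH → Form
⌜ Π ∧ₛ Σ ⌝ = pure Π ∧ᶠ spatial Σ

⋁-aux : SH → List SH → Form
⋁-aux ψ []       = ⌜ ψ ⌝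
⋁-aux ψ (ψ' ∷ r) = ⌜ ψ ⌝ ∨ᶠ ⋁-aux ψ' r

⋁ : List⁺ SH → Form
⋁ (ψ ∷ r) = ⋁-aux ψ r

OccT : Var → Term → Set
OccT z (var x) = z ≡ x
OccT z (lit n) = ⊥
OccT z (t ⊕ u) = OccT z t ⊎ OccT z u

OccP : Var → Pure → Set
OccP z (t ≐ u)  = OccT z t ⊎ OccT z u
OccP z (t ≼ u)  = OccT z t ⊎ OccT z u
OccP z (¬ᵖ p)   = OccP z p
OccP z (p ∧ᵖ q) = OccP z p ⊎ OccP z q
OccP z (p ∨ᵖ q) = OccP z p ⊎ OccP z q
OccP z (∃ᵖ x p) = z ≡ x ⊎ OccP z p
OccP z (∀ᵖ x p) = z ≡ x ⊎ OccP z p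

OccΣ : Var → Spatial → Set
OccΣ z emp             = ⊥
OccΣ z (t ↦⟨ u , v ⟩)  = OccT z t ⊎ OccT z u ⊎ OccT z v
OccΣ z (arr t u)       = OccT z t ⊎ OccT z u
OccΣ z (ls t u)        = OccT z t ⊎ OccT z u
OccΣ z (dll t u v w)   = OccT z t ⊎ OccT z u ⊎ OccT z v ⊎ OccT z w
OccΣ z (σ ✱ τ)         = OccΣ z σ ⊎ OccΣ z τ

OccSH : Var → SH → Set
OccSH z (Π ∧ₛ Σ) = OccP z Π ⊎ OccΣ z Σ

OccList : Var → List SH → Set
OccList z []      = ⊥
OccList z (ψ ∷ r) = OccSH z ψ ⊎ OccList z r

OccList⁺ : Var → List⁺ SH → Set
OccList⁺ z (ψ ∷ r) = OccSH z ψ ⊎ OccList z r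

Store : Set
Store = Var → ℕ

_[_≔_] : Store → Var → ℕ → Store
(s [ x ≔ n ]) y with y ≟ x
... | yes _ = n
... | no  _ = s y

⟦_⟧ₜ : Term → Store → ℕ
⟦ var x ⟧ₜ s = s x
⟦ lit n ⟧ₜ s = n
⟦ t ⊕ u ⟧ₜ s = ⟦ t ⟧ₜ s + ⟦ u ⟧ₜ s

record Heap : Set where
  field
    fun    : ℕ → Maybe (ℕ × ℕ)
    no-0   : fun 0 ≡ nothing
    finite : ∃[ N ] (∀ x → N ≤ x → fun x ≡ nothing)
open Heap public

IsEmp : Heap → Set
IsEmp h = ∀ x → fun h x ≡ nothing

PointsTo : Heap → ℕ → ℕ → ℕ → Set
PointsTo h a b c = fun h a ≡ just (b , c) × (∀ x → x ≢ a → fun h x ≡ nothing)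

ArrSem : Heap → ℕ → ℕ → Set
ArrSem h a b = a ≤ b × (∀ x → (Is-just (fun h x) → a ≤ x × x ≤ b)
                             × (a ≤ x × x ≤ b → Is-just (fun h x)))

Split : Heap → Heap → Heap → Set
Split h h₁ h₂ = ∀ x → (fun h₁ x ≡ nothing × fun h x ≡ fun h₂ x)
                    ⊎ (fun h₂ x ≡ nothing × fun h x ≡ fun h₁ x)

lsK : ℕ → ℕ → ℕ → Heap → Set
lsK 0       a b h = (0 ≢ 0) × IsEmp h
lsK (ℕ.suc k) a b h =
  (a ≡ b × IsEmp h)
  ⊎ (∃[ z ] ∃[ w ] ∃[ h₁ ] ∃[ h₂ ]
       (Split h h₁ h₂ × PointsTo h₁ a z w × lsK k z b h₂))

dllK : ℕ → ℕ → ℕ → ℕ → ℕ → Heap → Set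
dllK 0       a b c d h = (0 ≢ 0) × IsEmp h
dllK (ℕ.suc k) a b c d h =
  (a ≡ b × c ≡ d × IsEmp h)
  ⊎ (∃[ z ] ∃[ h₁ ] ∃[ h₂ ]
       (Split h h₁ h₂ × PointsTo h₁ a z d × dllK k z b c a h₂))

⟦_⟧ₚ : Pure → Store → Set
⟦ t ≐ u ⟧ₚ s  = ⟦ t ⟧ₜ s ≡ ⟦ u ⟧ₜ s
⟦ t ≼ u ⟧ₚ s  = ⟦ t ⟧ₜ s ≤ ⟦ u ⟧ₜ s
⟦ ¬ᵖ p ⟧ₚ s   = ¬ ⟦ p ⟧ₚ s
⟦ p ∧ᵖ q ⟧ₚ s = ⟦ p ⟧ₚ s × ⟦ q ⟧ₚ s
⟦ p ∨ᵖ q ⟧ₚ s = ⟦ p ⟧ₚ s ⊎ ⟦ q ⟧ₚ s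
⟦ ∃ᵖ x p ⟧ₚ s = ∃[ n ] ⟦ p ⟧ₚ (s [ x ≔ n ])
⟦ ∀ᵖ x p ⟧ₚ s = ∀ n → ⟦ p ⟧ₚ (s [ x ≔ n ])

_,_⊨Σ_ : Store → Heap → Spatial → Set
s , h ⊨Σ emp            = IsEmp h
s , h ⊨Σ (t ↦⟨ u , v ⟩) = PointsTo h (⟦ t ⟧ₜ s) (⟦ u ⟧ₜ s) (⟦ v ⟧ₜ s)
s , h ⊨Σ arr t u        = ArrSem h (⟦ t ⟧ₜ s) (⟦ u ⟧ₜ s)
s , h ⊨Σ ls t u         = ∃[ k ] lsK k (⟦ t ⟧ₜ s) (⟦ u ⟧ₜ s) h
s , h ⊨Σ dll t u v w    = ∃[ k ] dllK k (⟦ t ⟧ₜ s) (⟦ u ⟧ₜ s) (⟦ v ⟧ₜ s) (⟦ w ⟧ₜ s) h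
s , h ⊨Σ (σ ✱ τ)        = ∃[ h₁ ] ∃[ h₂ ] (Split h h₁ h₂ × s , h₁ ⊨Σ σ × s , h₂ ⊨Σ τ)

_,_⊨_ : Store → Heap → Form → Set
s , h ⊨ pure Π      = ⟦ Π ⟧ₚ s
s , h ⊨ spatial Σ   = s , h ⊨Σ Σ
s , h ⊨ (F ⋆ G)     = ∃[ h₁ ] ∃[ h₂ ] (Split h h₁ h₂ × s , h₁ ⊨ F × s , h₂ ⊨ G)
s , h ⊨ (F ∧ᶠ G)    = s , h ⊨ F × s , h ⊨ G
s , h ⊨ (F ∨ᶠ G)    = s , h ⊨ F ⊎ s , h ⊨ G
s , h ⊨ ∃ᶠ x F      = ∃[ n ] (s [ x ≔ n ]) , h ⊨ F

_⊨ᵉ_ : Form → Form → Set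
F ⊨ᵉ G = ∀ (s : Store) (h : Heap) → s , h ⊨ F → s , h ⊨ G

module Submission where

-- (1) ⇒ (2) is immediate: each left-hand side in (2) describes a model of
-- dll(t,u,v,w) ∗ φ whose segment has length 0, 1 or 3 (the middle cell
-- sitting at the value of z).
--
-- (2) ⇒ (1).  A model of dll(t,u,v,w) ∗ φ has a segment of length 0, of
-- length 1, or of length ≥ 2; the first two shapes are the first two
-- premises.  A segment of length ≥ 2 consists of a first cell t ↦ (a₁,w), a
-- middle segment dll(a₁,v,aₘ,t) and a last cell v ↦ (u,aₘ).  Pick an address
-- N that is fresh for the heap and larger than every term value of the ψᵢ,
-- set z := N, and replace the middle segment by the single cell
-- N ↦ (v,t).  The resulting "expanded" heap H satisfies the third premise,
-- hence some ψᵢ.  The collapse map undoes the expansion: it removes the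
-- cell N, reinserts the middle segment and redirects the pointers of t and
-- v.  It maps H back to the original heap, commutes with splitting, and sends
-- models G ⊆ H of spatial formulas whose terms stay below N to models of the
-- same formulas: points-to and array atoms never touch N, and list segments
-- passing through N are stretched by the middle segment.

open import Defs
open import Data.Nat using (ℕ; zero; suc; _+_; _≤_; _<_; _≟_; _≤?_; s≤s)
open import Data.Nat.Properties
  using (≤-trans; <-trans; ≤-<-trans; m≤m+n; m≤n+m; <⇒≢; <⇒≱; ≰⇒>; m<1+n⇒m<n∨m≡n)
open import Data.Maybe using (Maybe; just; nothing; Is-just; _<∣>_)
open import Data.Maybe.Relation.Unary.Any using (just)
open import Data.Maybe.Properties using (just-injective)
open import Data.Product using (_×_; _,_; ∃-syntax; proj₁; proj₂)
open import Data.Product.Properties using (,-injective)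
open import Data.Sum using (_⊎_; inj₁; inj₂)
open import Data.Empty using (⊥-elim)
open import Data.Unit using (⊤; tt)
open import Relation.Nullary using (¬_; yes; no)
open import Relation.Binary.PropositionalEquality
open import Data.List using (List; []; _∷_)
open import Data.List.NonEmpty using (List⁺; _∷_)
open import Function.Bundles using (_⇔_; mk⇔)

cell-injective : ∀ {p q p′ q′ : ℕ} →
  _≡_ {A = Maybe (ℕ × ℕ)} (just (p , q)) (just (p′ , q′)) → p ≡ p′ × q ≡ q′
cell-injective e = ,-injective (just-injective e)

nothing≢just : ∀ {c : ℕ × ℕ} → nothing ≢ just c
nothing≢just ()

-- Heaps agreeing at every address; there is no function extensionality,
-- so this is the equality under which satisfaction will be shown invariant.
record _≈ʰ_ (G G′ : Heap) : Set where
  constructor ext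
  field at : ∀ x → fun G x ≡ fun G′ x
open _≈ʰ_

≈-sym : ∀ {G G′} → G ≈ʰ G′ → G′ ≈ʰ G
≈-sym e = ext λ x → sym (at e x)

-- `Split G A B` (G = A + B) wrapped in a record, so that A and B can be
-- inferred from a proof of it.
record Splits (G A B : Heap) : Set where
  constructor splits
  field split : Split G A B
open Splits

splits-sym : ∀ {G A B} → Splits G A B → Splits G B A
splits-sym (splits sp) = splits λ x → swap (sp x)
  where
  swap : ∀ {P Q : Set} → P ⊎ Q → Q ⊎ P
  swap (inj₁ p) = inj₂ p
  swap (inj₂ q) = inj₁ q

module _ {G A B : Heap} (sp : Splits G A B) where

  left-in : ∀ {x c} → fun A x ≡ just c → fun G x ≡ just c
  left-in {x} a with split sp x
  ... | inj₁ (an , _) = ⊥-elim (nothing≢just (trans (sym an) a))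
  ... | inj₂ (_ , g) = trans g a

  left-excludes : ∀ {x c} → fun A x ≡ just c → fun B x ≡ nothing
  left-excludes {x} a with split sp x
  ... | inj₁ (an , _) = ⊥-elim (nothing≢just (trans (sym an) a))
  ... | inj₂ (bn , _) = bn

  outside-left : ∀ {x} → fun A x ≡ nothing → fun G x ≡ fun B x
  outside-left {x} an with split sp x
  ... | inj₁ (_ , g) = g
  ... | inj₂ (bn , g) = trans g (trans an (sym bn))

  outside-whole : ∀ {x} → fun G x ≡ nothing → fun A x ≡ nothing × fun B x ≡ nothing
  outside-whole {x} gn with split sp x
  ... | inj₁ (an , g) = an , trans (sym g) gn
  ... | inj₂ (bn , g) = trans (sym g) gn , bn

right-in : ∀ {G A B x c} → Splits G A B → fun B x ≡ just c → fun G x ≡ just c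
right-in sp = left-in (splits-sym sp)

right-excludes : ∀ {G A B x c} → Splits G A B → fun B x ≡ just c → fun A x ≡ nothing
right-excludes sp = left-excludes (splits-sym sp)

outside-both : ∀ {G A B x} → Splits G A B → fun A x ≡ nothing → fun B x ≡ nothing → fun G x ≡ nothing
outside-both sp an bn = trans (outside-left sp an) bn

splits-≈ : ∀ {G G′ A B} → G ≈ʰ G′ → Splits G A B → Splits G′ A B
splits-≈ e (splits sp) = splits λ x → move x (sp x)
  where
  move : ∀ x → _ → _
  move x (inj₁ (a , g)) = inj₁ (a , trans (sym (at e x)) g)
  move x (inj₂ (b , g)) = inj₂ (b , trans (sym (at e x)) g)

splits-≈ˡ : ∀ {G A A′ B} → A ≈ʰ A′ → Splits G A B → Splits G A′ B
splits-≈ˡ e (splits sp) = splits λ x → move x (sp x)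
  where
  move : ∀ x → _ → _
  move x (inj₁ (a , g)) = inj₁ (trans (sym (at e x)) a , g)
  move x (inj₂ (b , g)) = inj₂ (b , trans g (at e x))

split-empʳ : ∀ {G A B} → IsEmp B → Splits G A B → G ≈ʰ A
split-empʳ {G} {A} e sp = ext λ x → pointwise x (split sp x)
  where
  pointwise : ∀ x → _ → fun G x ≡ fun A x
  pointwise x (inj₁ (a , g)) = trans g (trans (e x) (sym a))
  pointwise x (inj₂ (_ , g)) = g

split-empˡ : ∀ {G A B} → IsEmp A → Splits G A B → G ≈ʰ B
split-empˡ e sp = split-empʳ e (splits-sym sp)

-- The empty heap, and the union of heaps (left-biased; used only on
-- disjoint heaps).
emptyʰ : Heap
emptyʰ = record { fun = λ _ → nothing ; no-0 = refl ; finite = 0 , λ _ _ → refl }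

emptyʰ-emp : IsEmp emptyʰ
emptyʰ-emp _ = refl

splits-emptyʳ : ∀ G → Splits G G emptyʰ
splits-emptyʳ G = splits λ x → inj₂ (refl , refl)

splits-emptyˡ : ∀ G → Splits G emptyʰ G
splits-emptyˡ G = splits λ x → inj₁ (refl , refl)

_∪ʰ_ : Heap → Heap → Heap
A ∪ʰ B = record { fun = λ x → fun A x <∣> fun B x ; no-0 = no-0′ ; finite = finite′ }
  where
  no-0′ : (fun A 0 <∣> fun B 0) ≡ nothing
  no-0′ rewrite no-0 A | no-0 B = refl
  finite′ : ∃[ N ] (∀ x → N ≤ x → (fun A x <∣> fun B x) ≡ nothing)
  finite′ with finite A | finite B
  ... | na , fa | nb , fb = na + nb , beyond
    where
    beyond : ∀ x → na + nb ≤ x → (fun A x <∣> fun B x) ≡ nothing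
    beyond x p rewrite fa x (≤-trans (m≤m+n na nb) p) | fb x (≤-trans (m≤n+m nb na) p) = refl

∪-outside-left : ∀ A B x → fun A x ≡ nothing → fun (A ∪ʰ B) x ≡ fun B x
∪-outside-left A B x e rewrite e = refl

∪-outside-right : ∀ A B x → fun B x ≡ nothing → fun (A ∪ʰ B) x ≡ fun A x
∪-outside-right A B x e with fun A x
... | just _ = refl
... | nothing = e

Disjoint : Heap → Heap → Set
Disjoint A B = ∀ x → fun A x ≡ nothing ⊎ fun B x ≡ nothing

splits-disjoint : ∀ {G A B} → Splits G A B → Disjoint A B
splits-disjoint (splits sp) x with sp x
... | inj₁ (a , _) = inj₁ a
... | inj₂ (b , _) = inj₂ b

splits-∪ : ∀ A B → Disjoint A B → Splits (A ∪ʰ B) A B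
splits-∪ A B d = splits λ x → pointwise x (d x)
  where
  pointwise : ∀ x → _ → _
  pointwise x (inj₁ e) = inj₁ (e , ∪-outside-left A B x e)
  pointwise x (inj₂ e) = inj₂ (e , ∪-outside-right A B x e)

∪-comm : ∀ A B → Disjoint A B → (A ∪ʰ B) ≈ʰ (B ∪ʰ A)
∪-comm A B d = ext λ x → pointwise x (d x)
  where
  pointwise : ∀ x → _ → _
  pointwise x (inj₁ e) = trans (∪-outside-left A B x e) (sym (∪-outside-right B A x e))
  pointwise x (inj₂ e) = trans (∪-outside-right A B x e) (sym (∪-outside-left B A x e))

reassocˡ : ∀ {G A X B Y} → Splits G A X → Splits X B Y →
  Splits G (A ∪ʰ B) Y × Splits (A ∪ʰ B) A B
reassocˡ {G} {A} {X} {B} {Y} (splits s₁) (splits s₂) =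
  splits (λ x → outer x (s₁ x) (s₂ x)) , splits (λ x → inner x (s₁ x) (s₂ x))
  where
  outer : ∀ x → _ → _ → _
  outer x (inj₁ (a , g₁)) (inj₁ (b , g₂)) = inj₁ (trans (∪-outside-left A B x a) b , trans g₁ g₂)
  outer x (inj₁ (a , g₁)) (inj₂ (y , g₂)) = inj₂ (y , trans g₁ (trans g₂ (sym (∪-outside-left A B x a))))
  outer x (inj₂ (xn , g₁)) (inj₁ (b , g₂)) = inj₂ (trans (sym g₂) xn , trans g₁ (sym (∪-outside-right A B x b)))
  outer x (inj₂ (xn , g₁)) (inj₂ (y , g₂)) =
    inj₂ (y , trans g₁ (sym (∪-outside-right A B x (trans (sym g₂) xn))))
  inner : ∀ x → _ → _ → _
  inner x (inj₁ (a , _)) _ = inj₁ (a , ∪-outside-left A B x a)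
  inner x (inj₂ (xn , _)) (inj₁ (b , _)) = inj₂ (b , ∪-outside-right A B x b)
  inner x (inj₂ (xn , _)) (inj₂ (y , g₂)) =
    inj₂ (trans (sym g₂) xn , ∪-outside-right A B x (trans (sym g₂) xn))

reassocʳ : ∀ {G A B A₁ A₂} → Splits G A B → Splits A A₁ A₂ →
  Splits G A₁ (A₂ ∪ʰ B) × Splits (A₂ ∪ʰ B) A₂ B
reassocʳ {B = B} {A₂ = A₂} s₁ s₂ with reassocˡ (splits-sym s₁) (splits-sym s₂)
... | outer , inner = splits-sym (splits-≈ˡ swapped outer) , splits-≈ swapped (splits-sym inner)
  where
  swapped : (B ∪ʰ A₂) ≈ʰ (A₂ ∪ʰ B)
  swapped = ∪-comm B A₂ (splits-disjoint inner)

record _⊆ʰ_ (G H : Heap) : Set where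
  constructor sub
  field below : ∀ x → fun G x ≡ nothing ⊎ fun G x ≡ fun H x
open _⊆ʰ_

⊆-refl : ∀ G → G ⊆ʰ G
⊆-refl G = sub λ x → inj₂ refl

⊆-left : ∀ {G A B H} → Splits G A B → G ⊆ʰ H → A ⊆ʰ H
⊆-left {A = A} {H = H} (splits sp) G⊆H = sub λ x → pointwise x (sp x) (below G⊆H x)
  where
  pointwise : ∀ x → _ → _ → fun A x ≡ nothing ⊎ fun A x ≡ fun H x
  pointwise x (inj₁ (a , _)) _ = inj₁ a
  pointwise x (inj₂ (_ , g)) (inj₁ n) = inj₁ (trans (sym g) n)
  pointwise x (inj₂ (_ , g)) (inj₂ e) = inj₂ (trans (sym g) e)

⊆-right : ∀ {G A B H} → Splits G A B → G ⊆ʰ H → B ⊆ʰ H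
⊆-right sp = ⊆-left (splits-sym sp)

⊆-just : ∀ {G H x c} → G ⊆ʰ H → fun G x ≡ just c → fun H x ≡ just c
⊆-just {x = x} G⊆H g with below G⊆H x
... | inj₁ n = ⊥-elim (nothing≢just (trans (sym n) g))
... | inj₂ e = trans (sym e) g

⊆-nothing : ∀ {G H x} → G ⊆ʰ H → fun H x ≡ nothing → fun G x ≡ nothing
⊆-nothing {x = x} G⊆H h with below G⊆H x
... | inj₁ n = n
... | inj₂ e = trans e h

-- The one-cell heap  a ↦ c  (for a ≠ 0).
singleton : ℕ → ℕ × ℕ → Heap
singleton a c = record { fun = cell ; no-0 = refl ; finite = suc a , beyond }
  where
  cell : ℕ → Maybe (ℕ × ℕ)
  cell zero = nothing
  cell (suc n) with suc n ≟ a
  ... | yes _ = just c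
  ... | no _ = nothing
  beyond : ∀ x → suc a ≤ x → cell x ≡ nothing
  beyond zero _ = refl
  beyond (suc x) p with suc x ≟ a
  ... | yes e = ⊥-elim (<⇒≢ p (sym e))
  ... | no _ = refl

singleton-elsewhere : ∀ a c x → x ≢ a → fun (singleton a c) x ≡ nothing
singleton-elsewhere a c zero _ = refl
singleton-elsewhere a c (suc x) n with suc x ≟ a
... | yes e = ⊥-elim (n e)
... | no _ = refl

singleton-at : ∀ a c → a ≢ 0 → fun (singleton a c) a ≡ just c
singleton-at zero c n = ⊥-elim (n refl)
singleton-at (suc a) c n with suc a ≟ suc a
... | yes _ = refl
... | no ne = ⊥-elim (ne refl)

singleton-↦ : ∀ a b c → a ≢ 0 → PointsTo (singleton a (b , c)) a b c
singleton-↦ a b c n = singleton-at a (b , c) n , singleton-elsewhere a (b , c)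

splits-singleton : ∀ a c B → fun B a ≡ nothing → Splits (singleton a c ∪ʰ B) (singleton a c) B
splits-singleton a c B bn = splits-∪ (singleton a c) B disjoint
  where
  disjoint : Disjoint (singleton a c) B
  disjoint x with x ≟ a
  ... | yes refl = inj₂ bn
  ... | no ne = inj₁ (singleton-elsewhere a c x ne)

emp-≈ : ∀ {G G′} → G ≈ʰ G′ → IsEmp G → IsEmp G′
emp-≈ e p x = trans (sym (at e x)) (p x)

↦-≈ : ∀ {G G′ a b c} → G ≈ʰ G′ → PointsTo G a b c → PointsTo G′ a b c
↦-≈ e (p , q) = trans (sym (at e _)) p , λ x n → trans (sym (at e x)) (q x n)

arr-≈ : ∀ {G G′ a b} → G ≈ʰ G′ → ArrSem G a b → ArrSem G′ a b
arr-≈ e (p , q) = p , λ x →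
  (λ j → proj₁ (q x) (subst Is-just (sym (at e x)) j)) , λ r → subst Is-just (at e x) (proj₂ (q x) r)

lsK-≈ : ∀ k {G G′ a b} → G ≈ʰ G′ → lsK k a b G → lsK k a b G′
lsK-≈ zero e (p , q) = p , emp-≈ e q
lsK-≈ (suc k) e (inj₁ (p , q)) = inj₁ (p , emp-≈ e q)
lsK-≈ (suc k) e (inj₂ (z , w , h₁ , h₂ , sp , pt , r)) =
  inj₂ (z , w , h₁ , h₂ , split (splits-≈ e (splits {_} {h₁} {h₂} sp)) , pt , r)

dllK-≈ : ∀ k {G G′ a b c d} → G ≈ʰ G′ → dllK k a b c d G → dllK k a b c d G′
dllK-≈ zero e (p , q) = p , emp-≈ e q
dllK-≈ (suc k) e (inj₁ (p , q , r)) = inj₁ (p , q , emp-≈ e r)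
dllK-≈ (suc k) e (inj₂ (z , h₁ , h₂ , sp , pt , r)) =
  inj₂ (z , h₁ , h₂ , split (splits-≈ e (splits {_} {h₁} {h₂} sp)) , pt , r)

satΣ-≈ : ∀ σ {s G G′} → G ≈ʰ G′ → s , G ⊨Σ σ → s , G′ ⊨Σ σ
satΣ-≈ emp e p = emp-≈ e p
satΣ-≈ (_ ↦⟨ _ , _ ⟩) e p = ↦-≈ e p
satΣ-≈ (arr _ _) e p = arr-≈ e p
satΣ-≈ (ls _ _) e (k , p) = k , lsK-≈ k e p
satΣ-≈ (dll _ _ _ _) e (k , p) = k , dllK-≈ k e p
satΣ-≈ (σ ✱ τ) e (h₁ , h₂ , sp , p , q) = h₁ , h₂ , split (splits-≈ e (splits {_} {h₁} {h₂} sp)) , p , q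

sat-≈ : ∀ F {s G G′} → G ≈ʰ G′ → s , G ⊨ F → s , G′ ⊨ F
sat-≈ (pure _) e p = p
sat-≈ (spatial σ) e p = satΣ-≈ σ e p
sat-≈ (F ⋆ F′) e (h₁ , h₂ , sp , p , q) = h₁ , h₂ , split (splits-≈ e (splits {_} {h₁} {h₂} sp)) , p , q
sat-≈ (F ∧ᶠ F′) e (p , q) = sat-≈ F e p , sat-≈ F′ e q
sat-≈ (F ∨ᶠ F′) e (inj₁ p) = inj₁ (sat-≈ F e p)
sat-≈ (F ∨ᶠ F′) e (inj₂ p) = inj₂ (sat-≈ F′ e p)
sat-≈ (∃ᶠ x F) e (n , p) = n , sat-≈ F e p

Agree : (Var → Set) → Store → Store → Set
Agree P s s′ = ∀ y → P y → s y ≡ s′ y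

agree-sym : ∀ {P s s′} → Agree P s s′ → Agree P s′ s
agree-sym a y p = sym (a y p)

update-at : ∀ s z n → (s [ z ≔ n ]) z ≡ n
update-at s z n with z ≟ z
... | yes _ = refl
... | no ne = ⊥-elim (ne refl)

agree-update : ∀ {P : Var → Set} s z n → ¬ P z → Agree P s (s [ z ≔ n ])
agree-update s z n np y py with y ≟ z
... | yes refl = ⊥-elim (np py)
... | no _ = refl

agree-bind : ∀ {P : Var → Set} {s s′} x n → Agree (λ y → y ≡ x ⊎ P y) s s′ →
  Agree P (s [ x ≔ n ]) (s′ [ x ≔ n ])
agree-bind x n a y p with y ≟ x
... | yes _ = refl
... | no _ = a y (inj₂ p)

term-agree : ∀ t {s s′} → Agree (λ y → OccT y t) s s′ → ⟦ t ⟧ₜ s ≡ ⟦ t ⟧ₜ s′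
term-agree (var x) a = a x refl
term-agree (lit n) a = refl
term-agree (t ⊕ u) a = cong₂ _+_ (term-agree t (λ y p → a y (inj₁ p))) (term-agree u (λ y p → a y (inj₂ p)))

pure-agree : ∀ p {s s′} → Agree (λ y → OccP y p) s s′ → ⟦ p ⟧ₚ s → ⟦ p ⟧ₚ s′
pure-agree (t ≐ u) a h =
  trans (sym (term-agree t (λ y q → a y (inj₁ q)))) (trans h (term-agree u (λ y q → a y (inj₂ q))))
pure-agree (t ≼ u) a h =
  subst₂ _≤_ (term-agree t (λ y q → a y (inj₁ q))) (term-agree u (λ y q → a y (inj₂ q))) h
pure-agree (¬ᵖ p) a h = λ q → h (pure-agree p (agree-sym a) q)
pure-agree (p ∧ᵖ q) a (h₁ , h₂) = pure-agree p (λ y o → a y (inj₁ o)) h₁ , pure-agree q (λ y o → a y (inj₂ o)) h₂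
pure-agree (p ∨ᵖ q) a (inj₁ h) = inj₁ (pure-agree p (λ y o → a y (inj₁ o)) h)
pure-agree (p ∨ᵖ q) a (inj₂ h) = inj₂ (pure-agree q (λ y o → a y (inj₂ o)) h)
pure-agree (∃ᵖ x p) a (n , h) = n , pure-agree p (agree-bind x n a) h
pure-agree (∀ᵖ x p) a h = λ n → pure-agree p (agree-bind x n a) (h n)

satΣ-agree : ∀ σ {s s′ G} → Agree (λ y → OccΣ y σ) s s′ → s , G ⊨Σ σ → s′ , G ⊨Σ σ
satΣ-agree emp a h = h
satΣ-agree (t ↦⟨ u , v ⟩) a h
  rewrite term-agree t (λ y q → a y (inj₁ q)) | term-agree u (λ y q → a y (inj₂ (inj₁ q)))
        | term-agree v (λ y q → a y (inj₂ (inj₂ q))) = h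
satΣ-agree (arr t u) a h
  rewrite term-agree t (λ y q → a y (inj₁ q)) | term-agree u (λ y q → a y (inj₂ q)) = h
satΣ-agree (ls t u) a h
  rewrite term-agree t (λ y q → a y (inj₁ q)) | term-agree u (λ y q → a y (inj₂ q)) = h
satΣ-agree (dll t u v w) a h
  rewrite term-agree t (λ y q → a y (inj₁ q)) | term-agree u (λ y q → a y (inj₂ (inj₁ q)))
        | term-agree v (λ y q → a y (inj₂ (inj₂ (inj₁ q))))
        | term-agree w (λ y q → a y (inj₂ (inj₂ (inj₂ q)))) = h
satΣ-agree (σ ✱ τ) a (h₁ , h₂ , sp , p , q) =
  h₁ , h₂ , sp , satΣ-agree σ (λ y o → a y (inj₁ o)) p , satΣ-agree τ (λ y o → a y (inj₂ o)) q

sh-agree : ∀ ψ {s s′ G} → Agree (λ y → OccSH y ψ) s s′ → s , G ⊨ ⌜ ψ ⌝ → s′ , G ⊨ ⌜ ψ ⌝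
sh-agree (Π ∧ₛ Σ) a (p , q) = pure-agree Π (λ y o → a y (inj₁ o)) p , satΣ-agree Σ (λ y o → a y (inj₂ o)) q

⋁-agree : ∀ ψs {s s′ G} → Agree (λ y → OccList⁺ y ψs) s s′ → s , G ⊨ ⋁ ψs → s′ , G ⊨ ⋁ ψs
⋁-agree (ψ ∷ r) = go ψ r
  where
  go : ∀ ψ r {s s′ G} → Agree (λ y → OccSH y ψ ⊎ OccList y r) s s′ → s , G ⊨ ⋁-aux ψ r → s′ , G ⊨ ⋁-aux ψ r
  go ψ [] a h = sh-agree ψ (λ y o → a y (inj₁ o)) h
  go ψ (ψ′ ∷ r) a (inj₁ h) = inj₁ (sh-agree ψ (λ y o → a y (inj₁ o)) h)
  go ψ (ψ′ ∷ r) a (inj₂ h) = inj₂ (go ψ′ r (λ y o → a y (inj₂ o)) h)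

dll⇒ls : ∀ k {a b c d G} → dllK k a b c d G → lsK k a b G
dll⇒ls zero (p , q) = p , q
dll⇒ls (suc k) (inj₁ (p , _ , r)) = inj₁ (p , r)
dll⇒ls (suc k) (inj₂ (z , h₁ , h₂ , sp , pt , r)) = inj₂ (z , _ , h₁ , h₂ , sp , pt , dll⇒ls k r)

ls-append : ∀ k {a b c A B G} → lsK k a b A → ∃[ k′ ] lsK k′ b c B → Splits G A B → ∃[ k″ ] lsK k″ a c G
ls-append zero (p , _) _ _ = ⊥-elim (p refl)
ls-append (suc k) (inj₁ (refl , e)) (k′ , q) sp = k′ , lsK-≈ k′ (≈-sym (split-empˡ e sp)) q
ls-append (suc k) {A = A} {B} (inj₂ (z , w , A₁ , A₂ , sp₁ , pt , r)) q sp
  with reassocʳ sp (splits {A} {A₁} {A₂} sp₁)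
... | outer , inner with ls-append k r q inner
... | k″ , res = suc k″ , inj₂ (z , w , A₁ , (A₂ ∪ʰ B) , split outer , pt , res)

dll-append : ∀ k {a b c d e f A B G} → dllK k a b c d A → ∃[ k′ ] dllK k′ b e f c B → Splits G A B →
  ∃[ k″ ] dllK k″ a e f d G
dll-append zero (p , _) _ _ = ⊥-elim (p refl)
dll-append (suc k) (inj₁ (refl , refl , em)) (k′ , q) sp = k′ , dllK-≈ k′ (≈-sym (split-empˡ em sp)) q
dll-append (suc k) {A = A} {B} (inj₂ (z , A₁ , A₂ , sp₁ , pt , r)) q sp
  with reassocʳ sp (splits {A} {A₁} {A₂} sp₁)
... | outer , inner with dll-append k r q inner
... | k″ , res = suc k″ , inj₂ (z , A₁ , (A₂ ∪ʰ B) , split outer , pt , res)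

dll-unfold-last : ∀ k {a b c d G} → dllK k a b c d G →
  (a ≡ b × c ≡ d × IsEmp G)
  ⊎ (∃[ e ] ∃[ G₀ ] ∃[ G₁ ] (Splits G G₀ G₁ × PointsTo G₁ c b e × ∃[ j ] dllK j a c e d G₀))
dll-unfold-last zero (p , _) = ⊥-elim (p refl)
dll-unfold-last (suc k) (inj₁ x) = inj₁ x
dll-unfold-last (suc k) {d = d} {G} (inj₂ (q , A₁ , A₂ , sp₁ , pt , r)) with dll-unfold-last k r
... | inj₁ (refl , refl , em) =
  inj₂ (d , emptyʰ , A₁ , splits-≈ (≈-sym (split-empʳ em (splits {G} {A₁} {A₂} sp₁))) (splits-emptyˡ A₁) ,
        pt , 1 , inj₁ (refl , refl , emptyʰ-emp))
... | inj₂ (e , R₀ , R₁ , sp₂ , ptR , j , dR) with reassocˡ (splits {G} {A₁} {A₂} sp₁) sp₂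
... | outer , inner = inj₂ (e , (A₁ ∪ʰ R₀) , R₁ , outer , ptR , suc j , inj₂ (q , A₁ , R₀ , split inner , pt , dR))

record LongDll (a b c d : ℕ) (G : Heap) : Set where
  field
    next prev : ℕ
    firstCell rest middle lastCell : Heap
    split-first : Splits G firstCell rest
    split-last  : Splits rest middle lastCell
    first↦      : PointsTo firstCell a next d
    last↦       : PointsTo lastCell c b prev
    middle-dll  : ∃[ j ] dllK j next c prev a middle

data DllShape (a b c d : ℕ) (G : Heap) : Set where
  empty  : a ≡ b → c ≡ d → IsEmp G → DllShape a b c d G
  single : a ≡ c → PointsTo G a b d → DllShape a b c d G
  long   : LongDll a b c d G → DllShape a b c d G

dll-shape : ∀ k {a b c d G} → dllK k a b c d G → DllShape a b c d G
dll-shape zero (p , _) = ⊥-elim (p refl)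
dll-shape (suc k) (inj₁ (ab , cd , em)) = empty ab cd em
dll-shape (suc k) {G = G} (inj₂ (next , F , R , sp , pt , r)) with dll-unfold-last k r
... | inj₁ (refl , refl , emR) = single refl (↦-≈ (≈-sym (split-empʳ emR (splits {G} {F} {R} sp))) pt)
... | inj₂ (prev , M , L , sp₂ , ptL , middle) = long (record
  { next = next ; prev = prev ; firstCell = F ; rest = R ; middle = M ; lastCell = L
  ; split-first = splits sp ; split-last = sp₂ ; first↦ = pt ; last↦ = ptL ; middle-dll = middle })

sum<ˡ : ∀ a b {n} → a + b < n → a < n
sum<ˡ a b p = ≤-<-trans (m≤m+n a b) p

sum<ʳ : ∀ a b {n} → a + b < n → b < n
sum<ʳ a b p = ≤-<-trans (m≤n+m b a) p

cellSum : Maybe (ℕ × ℕ) → ℕ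
cellSum nothing = 0
cellSum (just (p , q)) = p + q

valueSum : Heap → ℕ → ℕ
valueSum h zero = 0
valueSum h (suc n) = valueSum h n + cellSum (fun h n)

valueSum-bound : ∀ h n x {p q} → x < n → fun h x ≡ just (p , q) → p + q ≤ valueSum h n
valueSum-bound h zero x () e
valueSum-bound h (suc n) x {p} {q} lt e with m<1+n⇒m<n∨m≡n lt
... | inj₁ l = ≤-trans (valueSum-bound h n x l e) (m≤m+n (valueSum h n) (cellSum (fun h n)))
... | inj₂ refl rewrite e = m≤n+m (p + q) (valueSum h x)

record FreshAddress (h : Heap) (B N : ℕ) : Set where
  field
    above       : B < N
    nonzero     : N ≢ 0
    unused      : fun h N ≡ nothing
    not-address : ∀ {x c} → fun h x ≡ just c → x ≢ N
    not-value   : ∀ {x p q} → fun h x ≡ just (p , q) → p ≢ N × q ≢ N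

fresh-address : ∀ h B → ∃[ N ] FreshAddress h B N
fresh-address h B with finite h
... | D , beyond = N , record
  { above = s≤s (≤-trans (m≤n+m B V) (m≤n+m (V + B) D))
  ; nonzero = λ ()
  ; unused = beyond N D≤N
  ; not-address = λ e → <⇒≢ (<-trans (address<D e) (s≤s (m≤m+n D (V + B))))
  ; not-value = λ {x} {p} {q} e →
      <⇒≢ (sum<ˡ p q (value<N e)) , <⇒≢ (sum<ʳ p q (value<N e)) }
  where
  V = valueSum h D
  N = suc (D + (V + B))
  D≤N : D ≤ N
  D≤N = ≤-trans (m≤m+n D (V + B)) (m≤n+m (D + (V + B)) 1)
  address<D : ∀ {x c} → fun h x ≡ just c → x < D
  address<D {x} e with D ≤? x
  ... | yes p = ⊥-elim (nothing≢just (trans (sym (beyond x p)) e))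
  ... | no p = ≰⇒> p
  value<N : ∀ {x p q} → fun h x ≡ just (p , q) → p + q < N
  value<N {x} e = s≤s (≤-trans (valueSum-bound h D x (address<D e) e) (≤-trans (m≤m+n V B) (m≤n+m (V + B) D)))

BelowΣ : ℕ → Store → Spatial → Set
BelowΣ N s emp = ⊤
BelowΣ N s (a ↦⟨ b , c ⟩) = ⟦ a ⟧ₜ s < N × ⟦ b ⟧ₜ s < N × ⟦ c ⟧ₜ s < N
BelowΣ N s (arr a b) = ⟦ a ⟧ₜ s < N × ⟦ b ⟧ₜ s < N
BelowΣ N s (ls a b) = ⟦ a ⟧ₜ s < N × ⟦ b ⟧ₜ s < N
BelowΣ N s (dll a b c d) = ⟦ a ⟧ₜ s < N × ⟦ b ⟧ₜ s < N × ⟦ c ⟧ₜ s < N × ⟦ d ⟧ₜ s < N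
BelowΣ N s (σ ✱ τ) = BelowΣ N s σ × BelowΣ N s τ

termSumΣ : Spatial → Store → ℕ
termSumΣ emp s = 0
termSumΣ (a ↦⟨ b , c ⟩) s = ⟦ a ⟧ₜ s + (⟦ b ⟧ₜ s + ⟦ c ⟧ₜ s)
termSumΣ (arr a b) s = ⟦ a ⟧ₜ s + ⟦ b ⟧ₜ s
termSumΣ (ls a b) s = ⟦ a ⟧ₜ s + ⟦ b ⟧ₜ s
termSumΣ (dll a b c d) s = ⟦ a ⟧ₜ s + (⟦ b ⟧ₜ s + (⟦ c ⟧ₜ s + ⟦ d ⟧ₜ s))
termSumΣ (σ ✱ τ) s = termSumΣ σ s + termSumΣ τ s

termSum : List SH → Store → ℕ
termSum [] s = 0
termSum ((_ ∧ₛ σ) ∷ r) s = termSumΣ σ s + termSum r s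

termSum⁺ : List⁺ SH → Store → ℕ
termSum⁺ (ψ ∷ r) = termSum (ψ ∷ r)

below-termSum : ∀ σ {N s} → termSumΣ σ s < N → BelowΣ N s σ
below-termSum emp p = tt
below-termSum (a ↦⟨ b , c ⟩) {s = s} p =
  let A = ⟦ a ⟧ₜ s ; B = ⟦ b ⟧ₜ s ; C = ⟦ c ⟧ₜ s ; p′ = sum<ʳ A (B + C) p in
  sum<ˡ A (B + C) p , sum<ˡ B C p′ , sum<ʳ B C p′
below-termSum (arr a b) {s = s} p = sum<ˡ (⟦ a ⟧ₜ s) (⟦ b ⟧ₜ s) p , sum<ʳ (⟦ a ⟧ₜ s) (⟦ b ⟧ₜ s) p
below-termSum (ls a b) {s = s} p = sum<ˡ (⟦ a ⟧ₜ s) (⟦ b ⟧ₜ s) p , sum<ʳ (⟦ a ⟧ₜ s) (⟦ b ⟧ₜ s) p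
below-termSum (dll a b c d) {s = s} p =
  let A = ⟦ a ⟧ₜ s ; B = ⟦ b ⟧ₜ s ; C = ⟦ c ⟧ₜ s ; D = ⟦ d ⟧ₜ s
      p₁ = sum<ʳ A (B + (C + D)) p ; p₂ = sum<ʳ B (C + D) p₁
  in sum<ˡ A (B + (C + D)) p , sum<ˡ B (C + D) p₁ , sum<ˡ C D p₂ , sum<ʳ C D p₂
below-termSum (σ ✱ τ) {s = s} p =
  below-termSum σ (sum<ˡ (termSumΣ σ s) (termSumΣ τ s) p) , below-termSum τ (sum<ʳ (termSumΣ σ s) (termSumΣ τ s) p)

-- An expanded heap H: a segment whose interior is the single cell
-- N ↦ (v,t) between a first cell t ↦ (N,w) and a last cell v ↦ (u,N), with N
-- not referenced from anywhere else.  M is a segment dll(a₁,v,aₘ,t), disjoint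
-- from H, which the collapse puts in place of the cell N.
record Expansion : Set where
  field
    N t v u w a₁ aₘ : ℕ
    H M : Heap
    t≢N : t ≢ N
    v≢N : v ≢ N
    t≢v : t ≢ v
    u≢N : u ≢ N
    w≢N : w ≢ N
    H-t : fun H t ≡ just (N , w)
    H-N : fun H N ≡ just (v , t)
    H-v : fun H v ≡ just (u , N)
    next≢N : ∀ {x p q} → x ≢ t → fun H x ≡ just (p , q) → p ≢ N
    prev≢N : ∀ {x p q} → x ≢ v → fun H x ≡ just (p , q) → q ≢ N
    M-outside-H : ∀ {x c} → fun M x ≡ just c → fun H x ≡ nothing
    M-N : fun M N ≡ nothing
    M-t : fun M t ≡ nothing
    M-v : fun M v ≡ nothing
    M-dll : ∃[ j ] dllK j a₁ v aₘ t M

module Collapse (E : Expansion) where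
  open Expansion E

  whenDefined : Maybe (ℕ × ℕ) → Maybe (ℕ × ℕ) → Maybe (ℕ × ℕ)
  whenDefined nothing _ = nothing
  whenDefined (just _) m = m

  -- The collapse of a sub-heap G of H: drop N, point t to a₁ and v back to
  -- aₘ, and insert M if G owns the cell N.
  collapseAt : Heap → ℕ → Maybe (ℕ × ℕ)
  collapseAt G x with x ≟ N
  ... | yes _ = nothing
  ... | no _ with x ≟ t
  ...   | yes _ = whenDefined (fun G x) (just (a₁ , w))
  ...   | no _ with x ≟ v
  ...     | yes _ = whenDefined (fun G x) (just (u , aₘ))
  ...     | no _ with fun M x
  ...       | just c = whenDefined (fun G N) (just c)
  ...       | nothing = fun G x

  data Place (x : ℕ) : Set where
    at-N : x ≡ N → Place x
    at-t : x ≡ t → Place x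
    at-v : x ≡ v → Place x
    in-M : ∀ c → x ≢ N → x ≢ t → x ≢ v → fun M x ≡ just c → Place x
    elsewhere : x ≢ N → x ≢ t → x ≢ v → fun M x ≡ nothing → Place x

  place : ∀ x → Place x
  place x with x ≟ N
  ... | yes p = at-N p
  ... | no n₁ with x ≟ t
  ... | yes p = at-t p
  ... | no n₂ with x ≟ v
  ... | yes p = at-v p
  ... | no n₃ with fun M x in eq
  ... | just c = in-M c n₁ n₂ n₃ eq
  ... | nothing = elsewhere n₁ n₂ n₃ eq

  collapse-N : ∀ G → collapseAt G N ≡ nothing
  collapse-N G with N ≟ N
  ... | yes _ = refl
  ... | no ne = ⊥-elim (ne refl)

  collapse-t : ∀ G → collapseAt G t ≡ whenDefined (fun G t) (just (a₁ , w))
  collapse-t G with t ≟ N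
  ... | yes e = ⊥-elim (t≢N e)
  ... | no _ with t ≟ t
  ... | yes _ = refl
  ... | no ne = ⊥-elim (ne refl)

  collapse-v : ∀ G → collapseAt G v ≡ whenDefined (fun G v) (just (u , aₘ))
  collapse-v G with v ≟ N
  ... | yes e = ⊥-elim (v≢N e)
  ... | no _ with v ≟ t
  ... | yes e = ⊥-elim (t≢v (sym e))
  ... | no _ with v ≟ v
  ... | yes _ = refl
  ... | no ne = ⊥-elim (ne refl)

  collapse-M : ∀ G x c → x ≢ N → x ≢ t → x ≢ v → fun M x ≡ just c →
    collapseAt G x ≡ whenDefined (fun G N) (just c)
  collapse-M G x c n₁ n₂ n₃ e with x ≟ N
  ... | yes p = ⊥-elim (n₁ p)
  ... | no _ with x ≟ t
  ... | yes p = ⊥-elim (n₂ p)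
  ... | no _ with x ≟ v
  ... | yes p = ⊥-elim (n₃ p)
  ... | no _ rewrite e = refl

  collapse-elsewhere : ∀ G x → x ≢ N → x ≢ t → x ≢ v → fun M x ≡ nothing → collapseAt G x ≡ fun G x
  collapse-elsewhere G x n₁ n₂ n₃ e with x ≟ N
  ... | yes p = ⊥-elim (n₁ p)
  ... | no _ with x ≟ t
  ... | yes p = ⊥-elim (n₂ p)
  ... | no _ with x ≟ v
  ... | yes p = ⊥-elim (n₃ p)
  ... | no _ with fun M x
  ... | nothing = refl

  collapse-undefined : ∀ G x → fun G x ≡ nothing → fun M x ≡ nothing → collapseAt G x ≡ nothing
  collapse-undefined G x g m with place x
  ... | at-N refl = collapse-N G
  ... | at-t refl rewrite collapse-t G | g = refl
  ... | at-v refl rewrite collapse-v G | g = refl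
  ... | in-M c _ _ _ e = ⊥-elim (nothing≢just (trans (sym m) e))
  ... | elsewhere n₁ n₂ n₃ e = trans (collapse-elsewhere G x n₁ n₂ n₃ e) g

  collapse : Heap → Heap
  collapse G = record { fun = collapseAt G ; no-0 = collapse-undefined G 0 (no-0 G) (no-0 M) ; finite = bound }
    where
    bound : ∃[ B ] (∀ x → B ≤ x → collapseAt G x ≡ nothing)
    bound with finite G | finite M
    ... | nG , fG | nM , fM = nG + nM , λ x p →
      collapse-undefined G x (fG x (≤-trans (m≤m+n nG nM) p)) (fM x (≤-trans (m≤n+m nM nG) p))

  collapse-splits : ∀ {G A B} → Splits G A B → Splits (collapse G) (collapse A) (collapse B)
  collapse-splits {G} {A} {B} (splits sp) = splits λ x → pointwise x (place x)
    where
    SplitAt : Maybe (ℕ × ℕ) → Maybe (ℕ × ℕ) → Maybe (ℕ × ℕ) → Set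
    SplitAt g a b = (a ≡ nothing × g ≡ b) ⊎ (b ≡ nothing × g ≡ a)
    gated : ∀ {g a b} m → SplitAt g a b → SplitAt (whenDefined g m) (whenDefined a m) (whenDefined b m)
    gated m (inj₁ (refl , refl)) = inj₁ (refl , refl)
    gated m (inj₂ (refl , refl)) = inj₂ (refl , refl)
    pointwise : ∀ x → Place x → SplitAt (collapseAt G x) (collapseAt A x) (collapseAt B x)
    pointwise x (at-N refl) rewrite collapse-N G | collapse-N A | collapse-N B = inj₁ (refl , refl)
    pointwise x (at-t refl) rewrite collapse-t G | collapse-t A | collapse-t B = gated _ (sp t)
    pointwise x (at-v refl) rewrite collapse-v G | collapse-v A | collapse-v B = gated _ (sp v)
    pointwise x (in-M c n₁ n₂ n₃ e)
      rewrite collapse-M G x c n₁ n₂ n₃ e | collapse-M A x c n₁ n₂ n₃ e | collapse-M B x c n₁ n₂ n₃ e = gated _ (sp N)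
    pointwise x (elsewhere n₁ n₂ n₃ e)
      rewrite collapse-elsewhere G x n₁ n₂ n₃ e | collapse-elsewhere A x n₁ n₂ n₃ e
            | collapse-elsewhere B x n₁ n₂ n₃ e = sp x

  collapse-emp : ∀ {G} → IsEmp G → IsEmp (collapse G)
  collapse-emp {G} em x with place x
  ... | at-N refl = collapse-N G
  ... | at-t refl rewrite collapse-t G | em t = refl
  ... | at-v refl rewrite collapse-v G | em v = refl
  ... | in-M c n₁ n₂ n₃ e rewrite collapse-M G x c n₁ n₂ n₃ e | em N = refl
  ... | elsewhere n₁ n₂ n₃ e = trans (collapse-elsewhere G x n₁ n₂ n₃ e) (em x)

  collapse-unchanged : ∀ {G} → G ⊆ʰ H → fun G N ≡ nothing → fun G t ≡ nothing → fun G v ≡ nothing →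
    collapse G ≈ʰ G
  collapse-unchanged {G} G⊆H gN gt gv = ext λ x → pointwise x (place x)
    where
    pointwise : ∀ x → Place x → collapseAt G x ≡ fun G x
    pointwise x (at-N refl) = trans (collapse-N G) (sym gN)
    pointwise x (at-t refl) rewrite collapse-t G | gt = refl
    pointwise x (at-v refl) rewrite collapse-v G | gv = refl
    pointwise x (in-M c n₁ n₂ n₃ e) rewrite collapse-M G x c n₁ n₂ n₃ e | gN = sym (⊆-nothing G⊆H (M-outside-H e))
    pointwise x (elsewhere n₁ n₂ n₃ e) = collapse-elsewhere G x n₁ n₂ n₃ e

  whenDefined-domain : ∀ g {m} →
    (Is-just (whenDefined g (just m)) → Is-just g) × (Is-just g → Is-just (whenDefined g (just m)))
  whenDefined-domain nothing = (λ ()) , (λ ())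
  whenDefined-domain (just _) = (λ _ → just tt) , (λ _ → just tt)

  collapse-domain : ∀ {G} → G ⊆ʰ H → fun G N ≡ nothing →
    ∀ x → (Is-just (collapseAt G x) → Is-just (fun G x)) × (Is-just (fun G x) → Is-just (collapseAt G x))
  collapse-domain {G} G⊆H gN x with place x
  ... | at-N refl rewrite collapse-N G | gN = (λ ()) , (λ ())
  ... | at-t refl rewrite collapse-t G = whenDefined-domain (fun G t)
  ... | at-v refl rewrite collapse-v G = whenDefined-domain (fun G v)
  ... | in-M c n₁ n₂ n₃ e rewrite collapse-M G x c n₁ n₂ n₃ e | gN | ⊆-nothing G⊆H (M-outside-H e) = (λ ()) , (λ ())
  ... | elsewhere n₁ n₂ n₃ e rewrite collapse-elsewhere G x n₁ n₂ n₃ e = (λ j → j) , (λ j → j)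

  collapse-first : ∀ {A q r} → PointsTo A t q r → PointsTo (collapse A) t a₁ w
  collapse-first {A} (At , only) = first , λ x n → elsewhere′ x n (place x)
    where
    first : collapseAt A t ≡ just (a₁ , w)
    first rewrite collapse-t A | At = refl
    elsewhere′ : ∀ x → x ≢ t → Place x → collapseAt A x ≡ nothing
    elsewhere′ x n (at-N refl) = collapse-N A
    elsewhere′ x n (at-t refl) = ⊥-elim (n refl)
    elsewhere′ x n (at-v refl) rewrite collapse-v A | only v (λ e → t≢v (sym e)) = refl
    elsewhere′ x n (in-M c n₁ n₂ n₃ e) rewrite collapse-M A x c n₁ n₂ n₃ e | only N (λ e → t≢N (sym e)) = refl
    elsewhere′ x n (elsewhere n₁ n₂ n₃ e) = trans (collapse-elsewhere A x n₁ n₂ n₃ e) (only x n₂)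

  collapse-last : ∀ {A q r} → PointsTo A v q r → PointsTo (collapse A) v u aₘ
  collapse-last {A} (Av , only) = last , λ x n → elsewhere′ x n (place x)
    where
    last : collapseAt A v ≡ just (u , aₘ)
    last rewrite collapse-v A | Av = refl
    elsewhere′ : ∀ x → x ≢ v → Place x → collapseAt A x ≡ nothing
    elsewhere′ x n (at-N refl) = collapse-N A
    elsewhere′ x n (at-v refl) = ⊥-elim (n refl)
    elsewhere′ x n (at-t refl) rewrite collapse-t A | only t t≢v = refl
    elsewhere′ x n (in-M c n₁ n₂ n₃ e) rewrite collapse-M A x c n₁ n₂ n₃ e | only N (λ e → v≢N (sym e)) = refl
    elsewhere′ x n (elsewhere n₁ n₂ n₃ e) = trans (collapse-elsewhere A x n₁ n₂ n₃ e) (only x n₃)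

  collapse-N-cell : ∀ {B q r} → PointsTo B N q r → collapse B ≈ʰ M
  collapse-N-cell {B} (BN , only) = ext λ x → pointwise x (place x)
    where
    pointwise : ∀ x → Place x → collapseAt B x ≡ fun M x
    pointwise x (at-N refl) = trans (collapse-N B) (sym M-N)
    pointwise x (at-t refl) rewrite collapse-t B | only t t≢N = sym M-t
    pointwise x (at-v refl) rewrite collapse-v B | only v v≢N = sym M-v
    pointwise x (in-M c n₁ n₂ n₃ e) rewrite collapse-M B x c n₁ n₂ n₃ e | BN = sym e
    pointwise x (elsewhere n₁ n₂ n₃ e) = trans (collapse-elsewhere B x n₁ n₂ n₃ e) (trans (only x n₁) (sym e))

  collapse-N-dll : ∀ {B q r} → PointsTo B N q r → ∃[ j ] dllK j a₁ v aₘ t (collapse B)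
  collapse-N-dll pt with M-dll
  ... | j , d = j , dllK-≈ j (≈-sym (collapse-N-cell pt)) d

  collapse-other : ∀ {A p q r} → A ⊆ʰ H → PointsTo A p q r → p ≢ N → p ≢ t → p ≢ v → PointsTo (collapse A) p q r
  collapse-other A⊆H pt p≢N p≢t p≢v = ↦-≈ (≈-sym unchanged) pt
    where
    unchanged = collapse-unchanged A⊆H (proj₂ pt _ (λ e → p≢N (sym e)))
                  (proj₂ pt _ (λ e → p≢t (sym e))) (proj₂ pt _ (λ e → p≢v (sym e)))

  cell-in-H : ∀ {G A B p q r} → G ⊆ʰ H → Splits G A B → PointsTo A p q r → fun H p ≡ just (q , r)
  cell-in-H G⊆H sp pt = ⊆-just (⊆-left sp G⊆H) (proj₁ pt)

  mutual
    -- A list segment of G ⊆ H with ends different from N survives the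
    -- collapse: a passage t → N → v becomes t → M → v.
    ls-collapse : ∀ k {p b G} → G ⊆ʰ H → b ≢ N → p ≢ N → lsK k p b G → ∃[ k′ ] lsK k′ p b (collapse G)
    ls-collapse zero _ _ _ (x , _) = ⊥-elim (x refl)
    ls-collapse (suc k) _ _ _ (inj₁ (e , em)) = 1 , inj₁ (e , collapse-emp em)
    ls-collapse (suc k) {G = G} G⊆H b≢N p≢N (inj₂ (q , r , A₁ , A₂ , sp , pt , rest)) =
      ls-cell k G⊆H b≢N p≢N (splits {G} {A₁} {A₂} sp) pt rest

    ls-cell : ∀ k {p q r b G A₁ A₂} → G ⊆ʰ H → b ≢ N → p ≢ N → Splits G A₁ A₂ → PointsTo A₁ p q r →
      lsK k q b A₂ → ∃[ k′ ] lsK k′ p b (collapse G)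
    ls-cell k {p} {A₁ = A₁} {A₂} G⊆H b≢N p≢N sp pt rest with p ≟ t | p ≟ v
    ... | yes refl | _ with cell-injective (trans (sym H-t) (cell-in-H G⊆H sp pt))
    ...   | refl , refl with ls-from-N k (⊆-right sp G⊆H) b≢N rest
    ...     | k′ , res = suc k′ , inj₂ (a₁ , w , collapse A₁ , collapse A₂ , split (collapse-splits sp) , collapse-first pt , res)
    ls-cell k {A₁ = A₁} {A₂} G⊆H b≢N p≢N sp pt rest | no _ | yes refl with cell-injective (trans (sym H-v) (cell-in-H G⊆H sp pt))
    ...   | refl , refl with ls-collapse k (⊆-right sp G⊆H) b≢N u≢N rest
    ...     | k′ , res = suc k′ , inj₂ (u , aₘ , collapse A₁ , collapse A₂ , split (collapse-splits sp) , collapse-last pt , res)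
    ls-cell k {q = q} {r} {A₁ = A₁} {A₂ = A₂} G⊆H b≢N p≢N sp pt rest | no p≢t | no p≢v
      with ls-collapse k (⊆-right sp G⊆H) b≢N (next≢N p≢t (cell-in-H G⊆H sp pt)) rest
    ... | k′ , res =
      suc k′ , inj₂ (q , r , collapse A₁ , collapse A₂ , split (collapse-splits sp) , collapse-other (⊆-left sp G⊆H) pt p≢N p≢t p≢v , res)

    ls-from-N : ∀ k {b G} → G ⊆ʰ H → b ≢ N → lsK k N b G → ∃[ k′ ] lsK k′ a₁ b (collapse G)
    ls-from-N zero _ _ (x , _) = ⊥-elim (x refl)
    ls-from-N (suc k) _ b≢N (inj₁ (e , _)) = ⊥-elim (b≢N (sym e))
    ls-from-N (suc k) {G = G} G⊆H b≢N (inj₂ (q , r , B₁ , B₂ , sp , pt , rest)) =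
      ls-N-cell k G⊆H b≢N (splits {G} {B₁} {B₂} sp) pt rest

    ls-N-cell : ∀ k {q r b G B₁ B₂} → G ⊆ʰ H → b ≢ N → Splits G B₁ B₂ → PointsTo B₁ N q r →
      lsK k q b B₂ → ∃[ k′ ] lsK k′ a₁ b (collapse G)
    ls-N-cell k G⊆H b≢N sp pt rest with cell-injective (trans (sym H-N) (cell-in-H G⊆H sp pt))
    ... | refl , refl with collapse-N-dll pt
    ... | j , middle = ls-append j (dll⇒ls j middle) (ls-collapse k (⊆-right sp G⊆H) b≢N v≢N rest) (collapse-splits sp)

  -- Back pointers to N become back pointers to aₘ, the last cell of M.
  redirect : ℕ → ℕ
  redirect d with d ≟ N
  ... | yes _ = aₘ
  ... | no _ = d

  redirect-≢ : ∀ {d} → d ≢ N → redirect d ≡ d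
  redirect-≢ {d} n with d ≟ N
  ... | yes e = ⊥-elim (n e)
  ... | no _ = refl

  redirect-N : redirect N ≡ aₘ
  redirect-N with N ≟ N
  ... | yes _ = refl
  ... | no ne = ⊥-elim (ne refl)

  mutual
    dll-collapse : ∀ k {p b c d G} → G ⊆ʰ H → b ≢ N → c ≢ N → p ≢ N → dllK k p b c d G →
      ∃[ k′ ] dllK k′ p b c (redirect d) (collapse G)
    dll-collapse zero _ _ _ _ (x , _) = ⊥-elim (x refl)
    dll-collapse (suc k) _ _ c≢N _ (inj₁ (e , refl , em)) rewrite redirect-≢ c≢N = 1 , inj₁ (e , refl , collapse-emp em)
    dll-collapse (suc k) {G = G} G⊆H b≢N c≢N p≢N (inj₂ (q , A₁ , A₂ , sp , pt , rest)) =
      dll-cell k G⊆H b≢N c≢N p≢N (splits {G} {A₁} {A₂} sp) pt rest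

    dll-cell : ∀ k {p q b c d G A₁ A₂} → G ⊆ʰ H → b ≢ N → c ≢ N → p ≢ N → Splits G A₁ A₂ →
      PointsTo A₁ p q d → dllK k q b c p A₂ → ∃[ k′ ] dllK k′ p b c (redirect d) (collapse G)
    dll-cell k {p} {A₁ = A₁} {A₂ = A₂} G⊆H b≢N c≢N p≢N sp pt rest with p ≟ t | p ≟ v
    ... | yes refl | _ with cell-injective (trans (sym H-t) (cell-in-H G⊆H sp pt))
    ...   | refl , refl with dll-from-N k (⊆-right sp G⊆H) b≢N c≢N rest
    ...     | k′ , res rewrite redirect-≢ w≢N =
      suc k′ , inj₂ (a₁ , collapse A₁ , collapse A₂ , split (collapse-splits sp) , collapse-first pt , res)
    dll-cell k {A₁ = A₁} {A₂ = A₂} G⊆H b≢N c≢N p≢N sp pt rest | no _ | yes refl with cell-injective (trans (sym H-v) (cell-in-H G⊆H sp pt))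
    ...   | refl , refl with dll-collapse k (⊆-right sp G⊆H) b≢N c≢N u≢N rest
    ...     | k′ , res rewrite redirect-N | redirect-≢ v≢N =
      suc k′ , inj₂ (u , collapse A₁ , collapse A₂ , split (collapse-splits sp) , collapse-last pt , res)
    dll-cell k {q = q} {A₁ = A₁} {A₂ = A₂} G⊆H b≢N c≢N p≢N sp pt rest | no p≢t | no p≢v
      with dll-collapse k (⊆-right sp G⊆H) b≢N c≢N (next≢N p≢t (cell-in-H G⊆H sp pt)) rest
    ... | k′ , res rewrite redirect-≢ p≢N | redirect-≢ (prev≢N p≢v (cell-in-H G⊆H sp pt)) =
      suc k′ , inj₂ (q , collapse A₁ , collapse A₂ , split (collapse-splits sp) , collapse-other (⊆-left sp G⊆H) pt p≢N p≢t p≢v , res)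

    dll-from-N : ∀ k {b c G} → G ⊆ʰ H → b ≢ N → c ≢ N → dllK k N b c t G → ∃[ k′ ] dllK k′ a₁ b c t (collapse G)
    dll-from-N zero _ _ _ (x , _) = ⊥-elim (x refl)
    dll-from-N (suc k) _ b≢N _ (inj₁ (e , _)) = ⊥-elim (b≢N (sym e))
    dll-from-N (suc k) {G = G} G⊆H b≢N c≢N (inj₂ (q , B₁ , B₂ , sp , pt , rest)) =
      dll-N-cell k G⊆H b≢N c≢N (splits {G} {B₁} {B₂} sp) pt rest

    dll-N-cell : ∀ k {q b c G B₁ B₂} → G ⊆ʰ H → b ≢ N → c ≢ N → Splits G B₁ B₂ → PointsTo B₁ N q t →
      dllK k q b c N B₂ → ∃[ k′ ] dllK k′ a₁ b c t (collapse G)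
    dll-N-cell k G⊆H b≢N c≢N sp pt rest with cell-injective (trans (sym H-N) (cell-in-H G⊆H sp pt))
    ... | refl , _ with dll-collapse k (⊆-right sp G⊆H) b≢N c≢N v≢N rest | collapse-N-dll pt
    ... | k′ , res | j , middle rewrite redirect-N = dll-append j middle (k′ , res) (collapse-splits sp)

  satΣ-collapse : ∀ σ {s G} → BelowΣ N s σ → G ⊆ʰ H → s , G ⊨Σ σ → s , collapse G ⊨Σ σ
  satΣ-collapse emp _ _ m = collapse-emp m
  satΣ-collapse (a ↦⟨ b , c ⟩) {s} (a<N , b<N , c<N) G⊆H pt = collapse-other G⊆H pt (<⇒≢ a<N) a≢t a≢v
    where
    -- t and v hold pointers to N, which this cell does not.
    cell : fun H (⟦ a ⟧ₜ s) ≡ just (⟦ b ⟧ₜ s , ⟦ c ⟧ₜ s)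
    cell = ⊆-just G⊆H (proj₁ pt)
    a≢t : ⟦ a ⟧ₜ s ≢ t
    a≢t e = <⇒≢ b<N (proj₁ (cell-injective (trans (sym (subst (λ x → fun H x ≡ _) e cell)) H-t)))
    a≢v : ⟦ a ⟧ₜ s ≢ v
    a≢v e = <⇒≢ c<N (proj₂ (cell-injective (trans (sym (subst (λ x → fun H x ≡ _) e cell)) H-v)))
  satΣ-collapse (arr a b) {s} {G} (_ , b<N) G⊆H (a≤b , dom) =
    a≤b , λ x → (λ j → proj₁ (dom x) (proj₁ (same x) j)) , λ r → proj₂ (same x) (proj₂ (dom x) r)
    where
    -- the array ends below N, so G does not own N
    G-N : fun G N ≡ nothing
    G-N with fun G N in eq
    ... | nothing = refl
    ... | just _ = ⊥-elim (<⇒≱ b<N (proj₂ (proj₁ (dom N) (subst Is-just (sym eq) (just tt)))))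
    same = collapse-domain G⊆H G-N
  satΣ-collapse (ls a b) (a<N , b<N) G⊆H (k , m) = ls-collapse k G⊆H (<⇒≢ b<N) (<⇒≢ a<N) m
  satΣ-collapse (dll a b c d) (a<N , b<N , c<N , d<N) G⊆H (k , m)
    with dll-collapse k G⊆H (<⇒≢ b<N) (<⇒≢ c<N) (<⇒≢ a<N) m
  ... | k′ , res rewrite redirect-≢ (<⇒≢ d<N) = k′ , res
  satΣ-collapse (σ ✱ τ) {G = G} (bσ , bτ) G⊆H (G₁ , G₂ , sp , m₁ , m₂) =
    collapse G₁ , collapse G₂ , split (collapse-splits sp′) ,
    satΣ-collapse σ bσ (⊆-left sp′ G⊆H) m₁ , satΣ-collapse τ bτ (⊆-right sp′ G⊆H) m₂
    where
    sp′ = splits {G} {G₁} {G₂} sp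

  ⋁-collapse : ∀ ψs {s G} → termSum⁺ ψs s < N → G ⊆ʰ H → s , G ⊨ ⋁ ψs → s , collapse G ⊨ ⋁ ψs
  ⋁-collapse (ψ ∷ r) = go ψ r
    where
    disjunct : ∀ Π σ {s G} → termSumΣ σ s < N → G ⊆ʰ H → s , G ⊨ ⌜ Π ∧ₛ σ ⌝ → s , collapse G ⊨ ⌜ Π ∧ₛ σ ⌝
    disjunct Π σ bound G⊆H (π , m) = π , satΣ-collapse σ (below-termSum σ bound) G⊆H m
    go : ∀ ψ r {s G} → termSum (ψ ∷ r) s < N → G ⊆ʰ H → s , G ⊨ ⋁-aux ψ r → s , collapse G ⊨ ⋁-aux ψ r
    go (Π ∧ₛ σ) [] {s} bound G⊆H m = disjunct Π σ (sum<ˡ (termSumΣ σ s) 0 bound) G⊆H m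
    go (Π ∧ₛ σ) (ψ′ ∷ r) {s} bound G⊆H (inj₁ m) =
      inj₁ (disjunct Π σ (sum<ˡ (termSumΣ σ s) (termSum (ψ′ ∷ r) s) bound) G⊆H m)
    go (Π ∧ₛ σ) (ψ′ ∷ r) {s} bound G⊆H (inj₂ m) =
      inj₂ (go ψ′ r (sum<ʳ (termSumΣ σ s) (termSum (ψ′ ∷ r) s) bound) G⊆H m)

module Expand {h hd hφ : Heap} {T U V W B N : ℕ}
  (h-split : Splits h hd hφ) (L : LongDll T U V W hd) (fresh : FreshAddress h B N) where
  open LongDll L
  open FreshAddress fresh

  hd-T : fun hd T ≡ just (next , W)
  hd-T = left-in split-first (proj₁ first↦)

  rest-V : fun rest V ≡ just (U , prev)
  rest-V = right-in split-last (proj₁ last↦)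

  hd-V : fun hd V ≡ just (U , prev)
  hd-V = right-in split-first rest-V

  h-T : fun h T ≡ just (next , W)
  h-T = left-in h-split hd-T

  h-V : fun h V ≡ just (U , prev)
  h-V = left-in h-split hd-V

  T≢0 : T ≢ 0
  T≢0 e = nothing≢just (trans (sym (no-0 h)) (subst (λ x → fun h x ≡ just (next , W)) e h-T))

  V≢0 : V ≢ 0
  V≢0 e = nothing≢just (trans (sym (no-0 h)) (subst (λ x → fun h x ≡ just (U , prev)) e h-V))

  rest-T : fun rest T ≡ nothing
  rest-T = left-excludes split-first (proj₁ first↦)

  T≢V : T ≢ V
  T≢V e = nothing≢just (trans (sym rest-T) (subst (λ x → fun rest x ≡ just (U , prev)) (sym e) rest-V))

  hφ-T : fun hφ T ≡ nothing
  hφ-T = left-excludes h-split hd-T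

  hφ-V : fun hφ V ≡ nothing
  hφ-V = left-excludes h-split hd-V

  hφ-N : fun hφ N ≡ nothing
  hφ-N = proj₂ (outside-whole h-split unused)

  H₂ H₁ H : Heap
  H₂ = singleton V (U , N) ∪ʰ hφ
  H₁ = singleton N (V , T) ∪ʰ H₂
  H = singleton T (N , W) ∪ʰ H₁

  H₂-T : fun H₂ T ≡ nothing
  H₂-T = trans (∪-outside-left (singleton V (U , N)) hφ T (singleton-elsewhere V _ T T≢V)) hφ-T

  H₂-N : fun H₂ N ≡ nothing
  H₂-N = trans (∪-outside-left (singleton V (U , N)) hφ N (singleton-elsewhere V _ N (λ e → not-address h-V (sym e)))) hφ-N

  H₁-T : fun H₁ T ≡ nothing
  H₁-T = trans (∪-outside-left (singleton N (V , T)) H₂ T (singleton-elsewhere N _ T (not-address h-T))) H₂-T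

  H-split₁ : Splits H (singleton T (N , W)) H₁
  H-split₁ = splits-singleton T (N , W) H₁ H₁-T

  H-split₂ : Splits H₁ (singleton N (V , T)) H₂
  H-split₂ = splits-singleton N (V , T) H₂ H₂-N

  H-split₃ : Splits H₂ (singleton V (U , N)) hφ
  H-split₃ = splits-singleton V (U , N) hφ hφ-V

  H-t : fun H T ≡ just (N , W)
  H-t = left-in H-split₁ {T} (singleton-at T _ T≢0)

  H-N : fun H N ≡ just (V , T)
  H-N = right-in {x = N} H-split₁ (left-in H-split₂ {N} (singleton-at N _ nonzero))

  H-v : fun H V ≡ just (U , N)
  H-v = right-in {x = V} H-split₁ (right-in {x = V} H-split₂ (left-in H-split₃ {V} (singleton-at V _ V≢0)))

  H-elsewhere : ∀ {x} → x ≢ T → x ≢ N → x ≢ V → fun H x ≡ fun hφ x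
  H-elsewhere {x} x≢T x≢N x≢V =
    trans (∪-outside-left (singleton T (N , W)) H₁ x (singleton-elsewhere T _ x x≢T))
      (trans (∪-outside-left (singleton N (V , T)) H₂ x (singleton-elsewhere N _ x x≢N))
        (∪-outside-left (singleton V (U , N)) hφ x (singleton-elsewhere V _ x x≢V)))

  next≢N : ∀ {x p q} → x ≢ T → fun H x ≡ just (p , q) → p ≢ N
  next≢N {x} x≢T e with x ≟ N | x ≟ V
  ... | yes refl | _ = subst (_≢ N) (proj₁ (cell-injective (trans (sym H-N) e))) (not-address h-V)
  ... | no _ | yes refl = subst (_≢ N) (proj₁ (cell-injective (trans (sym H-v) e))) (proj₁ (not-value h-V))
  ... | no x≢N | no x≢V = proj₁ (not-value (right-in h-split (trans (sym (H-elsewhere x≢T x≢N x≢V)) e)))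

  prev≢N : ∀ {x p q} → x ≢ V → fun H x ≡ just (p , q) → q ≢ N
  prev≢N {x} x≢V e with x ≟ N | x ≟ T
  ... | yes refl | _ = subst (_≢ N) (proj₂ (cell-injective (trans (sym H-N) e))) (not-address h-T)
  ... | no _ | yes refl = subst (_≢ N) (proj₂ (cell-injective (trans (sym H-t) e))) (proj₂ (not-value h-T))
  ... | no x≢N | no x≢T = proj₂ (not-value (right-in h-split (trans (sym (H-elsewhere x≢T x≢N x≢V)) e)))

  middle-outside-H : ∀ {x c} → fun middle x ≡ just c → fun H x ≡ nothing
  middle-outside-H {x} e = trans (H-elsewhere x≢T x≢N x≢V) (left-excludes h-split hd-x)
    where
    rest-x = left-in split-last e
    hd-x = right-in split-first rest-x
    x≢T : x ≢ T
    x≢T refl = nothing≢just (trans (sym (right-excludes split-first rest-x)) (proj₁ first↦))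
    x≢N : x ≢ N
    x≢N = not-address (left-in h-split hd-x)
    x≢V : x ≢ V
    x≢V refl = nothing≢just (trans (sym (left-excludes split-last e)) (proj₁ last↦))

  expansion : Expansion
  expansion = record
    { N = N ; t = T ; v = V ; u = U ; w = W ; a₁ = next ; aₘ = prev ; H = H ; M = middle
    ; t≢N = not-address h-T ; v≢N = not-address h-V ; t≢v = T≢V
    ; u≢N = proj₁ (not-value h-V) ; w≢N = proj₂ (not-value h-T)
    ; H-t = H-t ; H-N = H-N ; H-v = H-v ; next≢N = next≢N ; prev≢N = prev≢N
    ; M-outside-H = middle-outside-H
    ; M-N = proj₁ (outside-whole split-last (proj₂ (outside-whole split-first (proj₁ (outside-whole h-split unused)))))
    ; M-t = proj₁ (outside-whole split-last rest-T)
    ; M-v = right-excludes split-last (proj₁ last↦)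
    ; M-dll = middle-dll }

  open Collapse expansion

  collapse-H : collapse H ≈ʰ h
  collapse-H = ext λ x → pointwise x (place x)
    where
    pointwise : ∀ x → Place x → collapseAt H x ≡ fun h x
    pointwise x (at-N refl) = trans (collapse-N H) (sym unused)
    pointwise x (at-t refl) = trans (collapse-t H) (trans (cong (λ m → whenDefined m (just (next , W))) H-t) (sym h-T))
    pointwise x (at-v refl) = trans (collapse-v H) (trans (cong (λ m → whenDefined m (just (U , prev))) H-v) (sym h-V))
    pointwise x (in-M c x≢N x≢T x≢V e) =
      trans (collapse-M H x c x≢N x≢T x≢V e)
        (trans (cong (λ m → whenDefined m (just c)) H-N) (sym (left-in h-split (right-in split-first (left-in split-last e)))))
    pointwise x (elsewhere x≢N x≢T x≢V e) =
      trans (collapse-elsewhere H x x≢N x≢T x≢V e) (trans (H-elsewhere x≢T x≢N x≢V) (sym (outside-left h-split hd-x)))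
      where
      hd-x : fun hd x ≡ nothing
      hd-x = outside-both split-first (proj₂ first↦ x x≢T)
               (outside-both split-last e (proj₂ last↦ x x≢V))

↦-cong : ∀ {G a b c a′ b′ c′} → a ≡ a′ → b ≡ b′ → c ≡ c′ → PointsTo G a b c → PointsTo G a′ b′ c′
↦-cong refl refl refl pt = pt

Segment : Term → Term → Term → Term → SH → Form
Segment t u v w φ = spatial (dll t u v w) ⋆ ⌜ φ ⌝

Length0 : Term → Term → Term → Term → SH → Form
Length0 t u v w φ = pure (t ≐ u) ∧ᶠ (pure (v ≐ w) ∧ᶠ ⌜ φ ⌝)

Length1 : Term → Term → Term → Term → SH → Form
Length1 t u v w φ = pure (t ≐ v) ∧ᶠ (spatial (t ↦⟨ u , w ⟩) ⋆ ⌜ φ ⌝)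

Length3 : Term → Term → Term → Term → SH → Var → Form
Length3 t u v w φ z =
  spatial (t ↦⟨ var z , w ⟩) ⋆ (spatial (var z ↦⟨ v , t ⟩) ⋆ (spatial (v ↦⟨ u , var z ⟩) ⋆ ⌜ φ ⌝))

FreshVar : Var → Term → Term → Term → Term → SH → List⁺ SH → Set
FreshVar z t u v w φ ψs = ¬ (OccT z t ⊎ OccT z u ⊎ OccT z v ⊎ OccT z w ⊎ OccSH z φ ⊎ OccList⁺ z ψs)

length0⊨segment : ∀ t u v w φ → Length0 t u v w φ ⊨ᵉ Segment t u v w φ
length0⊨segment t u v w φ s h (t≡u , v≡w , m) =
  emptyʰ , h , split (splits-emptyˡ h) , (1 , inj₁ (t≡u , v≡w , emptyʰ-emp)) , m

length1⊨segment : ∀ t u v w φ → Length1 t u v w φ ⊨ᵉ Segment t u v w φ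
length1⊨segment t u v w φ s h (t≡v , h₁ , h₂ , sp , pt , m) =
  h₁ , h₂ , sp , (2 , inj₂ (⟦ u ⟧ₜ s , h₁ , emptyʰ , split (splits-emptyʳ h₁) , pt , inj₁ (refl , sym t≡v , emptyʰ-emp))) , m

length3⊨segment : ∀ t u v w φ z → Length3 t u v w φ z ⊨ᵉ Segment t u v w φ
length3⊨segment t u v w φ z s h (h₁ , r₁ , sp₁ , pt₁ , h₂ , r₂ , sp₂ , pt₂ , h₃ , hφ , sp₃ , pt₃ , m)
  with reassocˡ (splits {r₁} {h₂} {r₂} sp₂) (splits {r₂} {h₃} {hφ} sp₃)
... | r₁-split , cells₂₃ with reassocˡ (splits {h} {h₁} {r₁} sp₁) r₁-split
... | h-split , cells = h₁ ∪ʰ (h₂ ∪ʰ h₃) , hφ , split h-split , (4 , segment) , m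
  where
  segment = inj₂ (s z , h₁ , h₂ ∪ʰ h₃ , split cells , pt₁ ,
            inj₂ (⟦ v ⟧ₜ s , h₂ , h₃ , split cells₂₃ , pt₂ ,
            inj₂ (⟦ u ⟧ₜ s , h₃ , emptyʰ , split (splits-emptyʳ h₃) , pt₃ , inj₁ (refl , refl , emptyʰ-emp))))

long-segment : ∀ t u v w φ ψs z → FreshVar z t u v w φ ψs → Length3 t u v w φ z ⊨ᵉ ⋁ ψs →
  ∀ {s h hd hφ} → Splits h hd hφ → LongDll (⟦ t ⟧ₜ s) (⟦ u ⟧ₜ s) (⟦ v ⟧ₜ s) (⟦ w ⟧ₜ s) hd →
  s , hφ ⊨ ⌜ φ ⌝ → s , h ⊨ ⋁ ψs
long-segment t u v w φ ψs z z-fresh three-cells {s} {h} {hφ = hφ} sp L φ-hφ with fresh-address h (termSum⁺ ψs s)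
... | N , fresh =
  sat-≈ (⋁ ψs) collapse-H (⋁-collapse ψs (FreshAddress.above fresh) (⊆-refl H) H⊨Ψ)
  where
  open Expand sp L fresh
  open Collapse expansion

  s′ = s [ z ≔ N ]
  T = ⟦ t ⟧ₜ s
  U = ⟦ u ⟧ₜ s
  V = ⟦ v ⟧ₜ s
  W = ⟦ w ⟧ₜ s

  keep : ∀ {P : Var → Set} →
    (P z → OccT z t ⊎ OccT z u ⊎ OccT z v ⊎ OccT z w ⊎ OccSH z φ ⊎ OccList⁺ z ψs) → Agree P s s′
  keep occ = agree-update s z N (λ o → z-fresh (occ o))

  inj⁵ : ∀ {A B C D E F : Set} → F → A ⊎ B ⊎ C ⊎ D ⊎ E ⊎ F
  inj⁵ o = inj₂ (inj₂ (inj₂ (inj₂ (inj₂ o))))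

  T≡ = term-agree t (keep inj₁)
  U≡ = term-agree u (keep (λ o → inj₂ (inj₁ o)))
  V≡ = term-agree v (keep (λ o → inj₂ (inj₂ (inj₁ o))))
  W≡ = term-agree w (keep (λ o → inj₂ (inj₂ (inj₂ (inj₁ o)))))
  N≡ = sym (update-at s z N)

  -- With z at N, the expanded heap satisfies the three-cell unfolding,
  -- hence Ψ, which does not mention z.
  expanded⊨length3 : s′ , H ⊨ Length3 t u v w φ z
  expanded⊨length3 =
    (singleton T (N , W) , H₁ , split H-split₁ , ↦-cong {singleton T (N , W)} T≡ N≡ W≡ (singleton-↦ _ N _ T≢0) ,
    (singleton N (V , T) , H₂ , split H-split₂ , ↦-cong {singleton N (V , T)} N≡ V≡ T≡ (singleton-↦ N _ _ (FreshAddress.nonzero fresh)) ,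
    (singleton V (U , N) , hφ , split H-split₃ , ↦-cong {singleton V (U , N)} V≡ U≡ N≡ (singleton-↦ _ _ N V≢0) ,
     sh-agree φ (keep (λ o → inj₂ (inj₂ (inj₂ (inj₂ (inj₁ o)))))) φ-hφ)))

  H⊨Ψ : s , H ⊨ ⋁ ψs
  H⊨Ψ = ⋁-agree ψs (agree-sym (keep inj⁵)) (three-cells s′ H expanded⊨length3)

segment-by-length : ∀ t u v w φ ψs z → FreshVar z t u v w φ ψs →
  Length0 t u v w φ ⊨ᵉ ⋁ ψs → Length1 t u v w φ ⊨ᵉ ⋁ ψs → Length3 t u v w φ z ⊨ᵉ ⋁ ψs →
  Segment t u v w φ ⊨ᵉ ⋁ ψs
segment-by-length t u v w φ ψs z z-fresh length0⊨Ψ length1⊨Ψ length3⊨Ψ s h (hd , hφ , sp , (k , seg) , φ-hφ)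
  with dll-shape k seg
... | empty t≡u v≡w em = length0⊨Ψ s h (t≡u , v≡w , sat-≈ ⌜ φ ⌝ (≈-sym (split-empˡ em (splits {h} {hd} {hφ} sp))) φ-hφ)
... | single t≡v pt = length1⊨Ψ s h (t≡v , hd , hφ , sp , pt , φ-hφ)
... | long L = long-segment t u v w φ ψs z z-fresh length3⊨Ψ (splits {h} {hd} {hφ} sp) L φ-hφ

proposition6p2 : (t u v w : Term) (φ : SH) (ψs : List⁺ SH) (z : Var) →
    ¬ (OccT z t ⊎ OccT z u ⊎ OccT z v ⊎ OccT z w ⊎ OccSH z φ ⊎ OccList⁺ z ψs) →
    ((spatial (dll t u v w) ⋆ ⌜ φ ⌝) ⊨ᵉ ⋁ ψs)
    ⇔ (((pure (t ≐ u) ∧ᶠ (pure (v ≐ w) ∧ᶠ ⌜ φ ⌝)) ⊨ᵉ ⋁ ψs)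
       × ((pure (t ≐ v) ∧ᶠ (spatial (t ↦⟨ u , w ⟩) ⋆ ⌜ φ ⌝)) ⊨ᵉ ⋁ ψs)
       × ((spatial (t ↦⟨ var z , w ⟩)
            ⋆ (spatial (var z ↦⟨ v , t ⟩)
            ⋆ (spatial (v ↦⟨ u , var z ⟩) ⋆ ⌜ φ ⌝))) ⊨ᵉ ⋁ ψs))
proposition6p2 t u v w φ ψs z z-fresh = mk⇔
  (λ segment⊨Ψ → (λ s h m → segment⊨Ψ s h (length0⊨segment t u v w φ s h m)) ,
                 (λ s h m → segment⊨Ψ s h (length1⊨segment t u v w φ s h m)) ,
                 (λ s h m → segment⊨Ψ s h (length3⊨segment t u v w φ z s h m)))
  (λ { (length0⊨Ψ , length1⊨Ψ , length3⊨Ψ) →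
       segment-by-length t u v w φ ψs z z-fresh length0⊨Ψ length1⊨Ψ length3⊨Ψ })
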